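{- Let $G$ be an additive subgroup of $\mathbb{F}_q$ with $|G|\ge 2$, let $\mathcal{A}=G^m$, and let $\mathbb{F}_{q'}$ be the largest subfield of $\mathbb{F}_q$ such that $G$ is an $\mathbb{F}_{q'}$-vector space. Let $L$ be a set of monomials in $\mathbb{F}_q[x_1,\ldots,x_m]$ of degree less than $|G|$ in every variable, closed under divisibility and having the Borel property. Then an affine transformation $T(x)=Mx+b$ lies in $\mathrm{Perm}_A(L(\mathcal{A}))$ if $b\in G^m$ and $M$ is a nonsingular lower triangular matrix with entries in $\mathbb{F}_{q'}$.
   Context: For a Cartesian set $\mathcal{A}=\prod_{i=1}^m A_i$ with $A_i\subseteq\mathbb{F}_q$, $n_i=|A_i|\ge 2$, $\Delta$ is the set of monomials $u$ with $\deg_{x_i}u<n_i$; for $L\subseteq\Delta$, $L(\mathcal{A})=\mathrm{Span}_{\mathbb{F}_q}\{(f(P_1),\ldots,f(P_n)) : f\in L\}$ where $\mathcal{A}=\{P_1,\ldots,P_n\}$. $I_{\mathcal{A}}=\left(\prod_{\alpha\in A_j}(x_j-\alpha)\right)_{j=1}^m$ and $\overline{g}$ is the unique element of $\mathrm{Span}_{\mathbb{F}_q}(\Delta)$ with $g-\overline{g}\in I_{\mathcal{A}}$. An affine transformation $T(x)=Mx+b$ ($M\in\mathbb{F}_q^{m\times m}$, $b\in\mathbb{F}_q^m$) acts on points by $P\mapsto MP+b$ and on polynomials by $T(f)=f(y_1,\ldots,y_m)$, $(y_1,\ldots,y_m)^t=M(x_1,\ldots,x_m)^t+b$. $T\in\mathrm{Perm}_A(L(\mathcal{A}))$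 means $T(\mathcal{A})=\mathcal{A}$ and $\overline{T(f)}\in\mathrm{Span}_{\mathbb{F}_q}(L)$ for all $f\in L$. $L$ has the Borel property if $u\in L$, $x_i\mid u$, $j<i$ imply $\frac{x_j}{x_i}u\in L$. (The paper denotes the matrix by $A$.) -}

module Defs where

open import Level using (Level; _⊔_)
open import Algebra.Bundles using (CommutativeRing)
open import Data.Nat as ℕ using (ℕ; zero; suc)
open import Data.Fin as Fin using (Fin)
open import Data.Vec as Vec using (Vec; lookup; tabulate; replicate; zipWith; updateAt)
open import Data.Vec.Properties using (≡-dec)
open import Data.List as List using (List; []; _∷_; _++_; map; concatMap; foldr; length)
open import Data.List.Relation.Unary.Any using (Any)
open import Data.List.Relation.Unary.All using (All)
open import Data.List.Relation.Unary.AllPairs using (AllPairs)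
open import Data.Product using (_×_; _,_; proj₁; proj₂; ∃; Σ)
open import Relation.Nullary using (¬_; yes; no)

record IsFiniteField {c ℓ} (R : CommutativeRing c ℓ) : Set (c ⊔ ℓ) where
  open CommutativeRing R
  field
    0≉1      : ¬ (0# ≈ 1#)
    inverse  : ∀ x → ¬ (x ≈ 0#) → ∃ λ y → x * y ≈ 1#
    elements : List Carrier
    complete : ∀ x → Any (x ≈_) elements

module Cartesian {c ℓ} (R : CommutativeRing c ℓ) where
  open CommutativeRing R

  record IsSubfield (K : Carrier → Set ℓ) : Set (c ⊔ ℓ) where
    field
      resp  : ∀ {x y} → x ≈ y → K x → K y
      has0  : K 0#
      has1  : K 1#
      +-cl  : ∀ {x y} → K x → K y → K (x + y)
      neg-cl : ∀ {x} → K x → K (- x)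
      *-cl  : ∀ {x y} → K x → K y → K (x * y)
      inv-cl : ∀ {x} → K x → ¬ (x ≈ 0#) → ∃ λ y → K y × (x * y ≈ 1#)

  _∈G_ : Carrier → List Carrier → Set (c ⊔ ℓ)
  x ∈G Gs = Any (x ≈_) Gs

  record IsAdditiveSubgroup (Gs : List Carrier) : Set (c ⊔ ℓ) where
    field
      distinct : AllPairs (λ x y → ¬ (x ≈ y)) Gs
      has0     : 0# ∈G Gs
      +-cl     : ∀ {x y} → x ∈G Gs → y ∈G Gs → (x + y) ∈G Gs
      neg-cl   : ∀ {x} → x ∈G Gs → (- x) ∈G Gs

  IsVectorSpaceOver : (K : Carrier → Set ℓ) → List Carrier → Set (c ⊔ ℓ)
  IsVectorSpaceOver K Gs = ∀ k g → K k → g ∈G Gs → (k * g) ∈G Gs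

  IsLargestSubfieldFor : (K : Carrier → Set ℓ) → List Carrier → Set (c ⊔ Level.suc ℓ)
  IsLargestSubfieldFor K Gs =
    IsSubfield K × IsVectorSpaceOver K Gs ×
    (∀ (K' : Carrier → Set ℓ) → IsSubfield K' → IsVectorSpaceOver K' Gs →
       ∀ x → K' x → K x)

  sumFin : ∀ {n} → (Fin n → Carrier) → Carrier
  sumFin {zero}  f = 0#
  sumFin {suc n} f = f Fin.zero + sumFin (λ i → f (Fin.suc i))

  Matrix : ℕ → Set c
  Matrix m = Fin m → Fin m → Carrier

  _·ᴹ_ : ∀ {m} → Matrix m → Matrix m → Matrix m
  (M ·ᴹ N) i j = sumFin (λ k → M i k * N k j)

  Idᴹ : ∀ {m} → Matrix m
  Idᴹ i j with i Fin.≟ j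
  ... | yes _ = 1#
  ... | no  _ = 0#

  Nonsingular : ∀ {m} → Matrix m → Set (c ⊔ ℓ)
  Nonsingular {m} M = ∃ λ (N : Matrix m) →
    (∀ i j → (M ·ᴹ N) i j ≈ Idᴹ i j) × (∀ i j → (N ·ᴹ M) i j ≈ Idᴹ i j)

  LowerTriangular : ∀ {m} → Matrix m → Set ℓ
  LowerTriangular M = ∀ i j → i Fin.< j → M i j ≈ 0#

  Point : ℕ → Set c
  Point m = Fin m → Carrier

  applyAffine : ∀ {m} → Matrix m → Point m → Point m → Point m
  applyAffine M b P i = sumFin (λ k → M i k * P k) + b i

  _∈𝒜_ : ∀ {m} → Point m → List Carrier → Set (c ⊔ ℓ)
  P ∈𝒜 Gs = ∀ i → P i ∈G Gs

  -- Polynomials in m variables: finite lists of terms (coefficient,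
  -- exponent vector); two polynomials are equal iff all coefficients agree.

  Monomial : ℕ → Set
  Monomial m = Vec ℕ m

  Poly : ℕ → Set c
  Poly m = List (Carrier × Monomial m)

  coeff : ∀ {m} → Poly m → Monomial m → Carrier
  coeff []            d = 0#
  coeff ((a , e) ∷ p) d with ≡-dec ℕ._≟_ e d
  ... | yes _ = a + coeff p d
  ... | no  _ = coeff p d

  _≃ₚ_ : ∀ {m} → Poly m → Poly m → Set ℓ
  p ≃ₚ q = ∀ d → coeff p d ≈ coeff q d

  _+ₚ_ : ∀ {m} → Poly m → Poly m → Poly m
  p +ₚ q = p ++ q

  -ₚ_ : ∀ {m} → Poly m → Poly m
  -ₚ p = map (λ t → (- proj₁ t , proj₂ t)) p

  _*ₚ_ : ∀ {m} → Poly m → Poly m → Poly m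
  p *ₚ q = concatMap (λ t → map (λ s → (proj₁ t * proj₁ s , zipWith ℕ._+_ (proj₂ t) (proj₂ s))) q) p

  constₚ : ∀ {m} → Carrier → Poly m
  constₚ {m} a = (a , replicate m 0) ∷ []

  oneₚ : ∀ {m} → Poly m
  oneₚ = constₚ 1#

  varₚ : ∀ {m} → Fin m → Poly m
  varₚ i = (1# , tabulate (λ j → unit j)) ∷ []
    where
    unit : _ → ℕ
    unit j with i Fin.≟ j
    ... | yes _ = 1
    ... | no  _ = 0

  monₚ : ∀ {m} → Monomial m → Poly m
  monₚ e = (1# , e) ∷ []

  _^ₚ_ : ∀ {m} → Poly m → ℕ → Poly m
  p ^ₚ zero  = oneₚ
  p ^ₚ suc n = p *ₚ (p ^ₚ n)

  sumFinₚ : ∀ {m n} → (Fin n → Poly m) → Poly m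
  sumFinₚ {n = zero}  f = []
  sumFinₚ {n = suc n} f = f Fin.zero +ₚ sumFinₚ (λ i → f (Fin.suc i))

  prodFinₚ : ∀ {m n} → (Fin n → Poly m) → Poly m
  prodFinₚ {n = zero}  f = oneₚ
  prodFinₚ {n = suc n} f = f Fin.zero *ₚ prodFinₚ (λ i → f (Fin.suc i))

  prodListₚ : ∀ {m} → List (Poly m) → Poly m
  prodListₚ = foldr _*ₚ_ oneₚ

  affineImage : ∀ {m} → Matrix m → Point m → Monomial m → Poly m
  affineImage M b e =
    prodFinₚ (λ i → (sumFinₚ (λ k → constₚ (M i k) *ₚ varₚ k) +ₚ constₚ (b i)) ^ₚ lookup e i)

  idealGen : ∀ {m} → List Carrier → Fin m → Poly m
  idealGen Gs j = prodListₚ (map (λ α → varₚ j +ₚ constₚ (- α)) Gs)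

  InIdeal : ∀ {m} → List Carrier → Poly m → Set (c ⊔ ℓ)
  InIdeal {m} Gs g = ∃ λ (Q : Fin m → Poly m) → g ≃ₚ sumFinₚ (λ j → Q j *ₚ idealGen Gs j)

  InSpan : ∀ {m} → (Monomial m → Set) → Poly m → Set c
  InSpan L h = All (λ t → L (proj₂ t)) h

  -- \overline{g} ∈ Span(L), for L ⊆ Δ: since the reduction \overline{g} is
  -- the unique element of Span(Δ) with g - \overline{g} ∈ I_𝒜, this says
  -- some h ∈ Span(L) satisfies g - h ∈ I_𝒜.
  ReductionInSpan : ∀ {m} → List Carrier → (Monomial m → Set) → Poly m → Set (c ⊔ ℓ)
  ReductionInSpan Gs L g = ∃ λ h → InSpan L h × InIdeal Gs (g +ₚ (-ₚ h))

  InPermA : ∀ {m} → List Carrier → (Monomial m → Set) → Matrix m → Point m → Set (c ⊔ ℓ)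
  InPermA Gs L M b =
    (∀ P → P ∈𝒜 Gs → applyAffine M b P ∈𝒜 Gs) ×
    (∀ Q → Q ∈𝒜 Gs → ∃ λ P → P ∈𝒜 Gs × (∀ i → applyAffine M b P i ≈ Q i)) ×
    (∀ e → L e → ReductionInSpan Gs L (affineImage M b e))

  InΔ : ∀ {m} → List Carrier → (Monomial m → Set) → Set
  InΔ Gs L = ∀ e → L e → ∀ i → lookup e i ℕ.< length Gs

  DivisibilityClosed : ∀ {m} → (Monomial m → Set) → Set
  DivisibilityClosed L = ∀ e d → L e → (∀ i → lookup d i ℕ.≤ lookup e i) → L d

  Borel : ∀ {m} → (Monomial m → Set) → Set
  Borel L = ∀ e i j → L e → 1 ℕ.≤ lookup e i → j Fin.< i →
    L (updateAt (updateAt e i ℕ.pred) j suc)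

{-# OPTIONS --safe #-}
-- T maps G^m into itself because b ∈ G^m and G is a vector space over the field K containing the
-- entries of M.  It maps G^m onto itself because the inverse of the lower triangular M is again
-- lower triangular with entries in K (forward substitution, row by row).
--
-- For the polynomial condition no reduction modulo I_𝒜 is needed: M being lower triangular,
-- T(x^e) = ∏ᵢ (Σ_{k ≤ i} M_ik x_k + b_i)^{e_i} once the vanishing entries are deleted, and every
-- monomial of this product arises from x^e by trading some factors x_i for an x_k with k ≤ i
-- (allowed in L by the Borel property) or for 1 (allowed since L is closed under divisibility).
module Submission where

open import Defs
open import Level using (_⊔_)
open import Algebra.Bundles using (CommutativeMonoid; CommutativeRing)
open import Data.Nat as ℕ using (ℕ; zero; suc; _≤_)
import Data.Nat.Properties as ℕₚ
open import Data.Fin as Fin using (Fin)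
import Data.Fin.Properties as Fin
import Data.Fin.Induction as Fin
open import Data.Vec.Functional using (Vector; removeAt)
open import Data.Vec using (lookup; tabulate; zipWith; updateAt)
open import Data.Vec.Properties
  using (≡-dec; lookup∘tabulate; tabulate∘lookup; lookup-zipWith; lookup-replicate;
         lookup∘updateAt; lookup∘updateAt′)
open import Data.List as List using (List; []; _∷_; _++_; map; length)
import Data.List.Properties as List
open import Data.List.Relation.Unary.All as All using (All; []; _∷_)
open import Data.List.Relation.Unary.All.Properties using (++⁺; map⁺; concat⁺)
open import Data.Product using (_×_; _,_; proj₁; proj₂; ∃)
open import Function using (_∘_; _∋_)
import Induction.WellFounded as WF
open import Relation.Nullary using (¬_; yes; no)
open import Relation.Nullary.Negation using (contradiction)
open import Relation.Binary.PropositionalEquality as ≡ using (_≡_; _≢_)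
open import Relation.Unary using (Pred)
open import Relation.Binary.Definitions using (tri<; tri≈; tri>)

module SumProperties {c ℓ} (M : CommutativeMonoid c ℓ) where
  open CommutativeMonoid M
  open import Algebra.Properties.CommutativeMonoid.Sum M public using (sum)
  open import Algebra.Properties.CommutativeMonoid.Sum M
    using (sum-remove; sum-cong-≋; sum-replicate-zero)
  open import Relation.Binary.Reasoning.Setoid setoid

  module _ {p} {P : Pred Carrier p} (P-ε : P ε) (P-∙ : ∀ {x y} → P x → P y → P (x ∙ y)) where

    sum-closed : ∀ {n} (f : Vector Carrier n) → (∀ i → P (f i)) → P (sum f)
    sum-closed {zero}  f f∈P = P-ε
    sum-closed {suc n} f f∈P = P-∙ (f∈P Fin.zero) (sum-closed (f ∘ Fin.suc) (f∈P ∘ Fin.suc))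

    sum-pivot : ∀ {n} (f : Vector Carrier n) i → (∀ j → j ≢ i → P (f j)) →
                ∃ λ s → P s × sum f ≈ f i ∙ s
    sum-pivot {suc n} f i f∈P =
      sum (removeAt f i) ,
      sum-closed (removeAt f i) (λ j → f∈P _ (Fin.punchInᵢ≢i i j)) ,
      sum-remove f

  sum-δ : ∀ {n} (f : Vector Carrier n) i → (∀ j → j ≢ i → f j ≈ ε) → sum f ≈ f i
  sum-δ f i f≈ε with sum-pivot refl (λ x≈ε y≈ε → trans (∙-cong x≈ε y≈ε) (identityˡ ε)) f i f≈ε
  ... | s , s≈ε , sum≈ = begin
    sum f    ≈⟨ sum≈ ⟩
    f i ∙ s  ≈⟨ ∙-congˡ s≈ε ⟩
    f i ∙ ε  ≈⟨ identityʳ (f i) ⟩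
    f i      ∎

module CartesianProperties {c ℓ} (R : CommutativeRing c ℓ) where
  open CommutativeRing R hiding (zero)
  open Cartesian R
  open import Algebra.Properties.Semiring.Sum semiring
    using (sum; sum-cong-≋; ∑-comm; *-distribˡ-sum; *-distribʳ-sum)
  open import Algebra.Properties.AbelianGroup +-abelianGroup
    using (//-rightDividesˡ; //-rightDividesʳ; ⁻¹-∙-comm; ε⁻¹≈ε)
  open SumProperties +-commutativeMonoid using (sum-closed; sum-pivot; sum-δ)
  open import Relation.Binary.Reasoning.Setoid setoid

  sumFin≡sum : ∀ {n} (f : Fin n → Carrier) → sumFin f ≡ sum f
  sumFin≡sum {zero}  f = ≡.refl
  sumFin≡sum {suc n} f = ≡.cong (f Fin.zero +_) (sumFin≡sum (f ∘ Fin.suc))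

  Idᴹ-diag : ∀ {m} (i : Fin m) → Idᴹ i i ≈ 1#
  Idᴹ-diag i with i Fin.≟ i
  ... | yes _   = refl
  ... | no i≢i = contradiction ≡.refl i≢i

  Idᴹ-off : ∀ {m} {i j : Fin m} → i ≢ j → Idᴹ i j ≈ 0#
  Idᴹ-off {i = i} {j} i≢j with i Fin.≟ j
  ... | yes i≡j = contradiction i≡j i≢j
  ... | no _    = refl

  infixr 7 _·ᵛ_
  _·ᵛ_ : ∀ {m} → Matrix m → Point m → Point m
  (A ·ᵛ v) i = sumFin (λ k → A i k * v k)

  ·ᵛ-congˡ : ∀ {m} {A B : Matrix m} → (∀ i j → A i j ≈ B i j) → ∀ v i → (A ·ᵛ v) i ≈ (B ·ᵛ v) i
  ·ᵛ-congˡ {A = A} {B} A≈B v i = begin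
    (A ·ᵛ v) i                ≡⟨ sumFin≡sum (λ k → A i k * v k) ⟩
    sum (λ k → A i k * v k)   ≈⟨ sum-cong-≋ (λ k → *-congʳ (A≈B i k)) ⟩
    sum (λ k → B i k * v k)   ≡⟨ sumFin≡sum (λ k → B i k * v k) ⟨
    (B ·ᵛ v) i                ∎

  ·ᵛ-assoc : ∀ {m} (A B : Matrix m) v i → (A ·ᵛ B ·ᵛ v) i ≈ ((A ·ᴹ B) ·ᵛ v) i
  ·ᵛ-assoc A B v i = begin
    (A ·ᵛ B ·ᵛ v) i                                ≡⟨ sumFin≡sum (λ k → A i k * (B ·ᵛ v) k) ⟩
    sum (λ k → A i k * (B ·ᵛ v) k)                 ≈⟨ sum-cong-≋ distribute ⟩
    sum (λ k → sum (λ l → A i k * (B k l * v l)))  ≈⟨ sum-cong-≋ (λ k → sum-cong-≋ (reassociate k)) ⟩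
    sum (λ k → sum (λ l → A i k * B k l * v l))    ≈⟨ ∑-comm (λ k l → A i k * B k l * v l) ⟩
    sum (λ l → sum (λ k → A i k * B k l * v l))    ≈⟨ sum-cong-≋ collect ⟩
    sum (λ l → (A ·ᴹ B) i l * v l)                 ≡⟨ sumFin≡sum (λ l → (A ·ᴹ B) i l * v l) ⟨
    ((A ·ᴹ B) ·ᵛ v) i                              ∎
    where
    distribute : ∀ k → A i k * (B ·ᵛ v) k ≈ sum (λ l → A i k * (B k l * v l))
    distribute k = trans (*-congˡ (reflexive (sumFin≡sum (λ l → B k l * v l))))
                         (*-distribˡ-sum (A i k) (λ l → B k l * v l))
    reassociate : ∀ k l → A i k * (B k l * v l) ≈ A i k * B k l * v l
    reassociate k l = sym (*-assoc (A i k) (B k l) (v l))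
    collect : ∀ l → sum (λ k → A i k * B k l * v l) ≈ (A ·ᴹ B) i l * v l
    collect l = trans (sym (*-distribʳ-sum (v l) (λ k → A i k * B k l)))
                      (*-congʳ (reflexive (≡.sym (sumFin≡sum (λ k → A i k * B k l)))))

  Idᴹ-·ᵛ : ∀ {m} (v : Point m) i → (Idᴹ ·ᵛ v) i ≈ v i
  Idᴹ-·ᵛ v i = begin
    (Idᴹ ·ᵛ v) i               ≡⟨ sumFin≡sum (λ k → Idᴹ i k * v k) ⟩
    sum (λ k → Idᴹ i k * v k)  ≈⟨ sum-δ (λ k → Idᴹ i k * v k) i off-diagonal ⟩
    Idᴹ i i * v i              ≈⟨ *-congʳ (Idᴹ-diag i) ⟩
    1# * v i                   ≈⟨ *-identityˡ (v i) ⟩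
    v i                        ∎
    where
    off-diagonal : ∀ k → k ≢ i → Idᴹ i k * v k ≈ 0#
    off-diagonal k k≢i = trans (*-congʳ (Idᴹ-off (k≢i ∘ ≡.sym))) (zeroˡ (v k))

  module SubfieldProperties {K : Carrier → Set ℓ} (K-subfield : IsSubfield K) where
    open IsSubfield K-subfield

    ≈0⇒∈K : ∀ {x} → x ≈ 0# → K x
    ≈0⇒∈K x≈0 = resp (sym x≈0) has0

    Idᴹ∈K : ∀ {m} (i j : Fin m) → K (Idᴹ i j)
    Idᴹ∈K i j with i Fin.≟ j
    ... | yes _ = has1
    ... | no  _ = has0

    *-cancelˡ-∈K : ∀ {x z} → K x → ¬ x ≈ 0# → K (x * z) → K z
    *-cancelˡ-∈K {x} {z} x∈K x≉0 xz∈K with inv-cl x∈K x≉0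
    ... | y , y∈K , xy≈1 = resp yxz≈z (*-cl y∈K xz∈K)
      where
      yxz≈z : y * (x * z) ≈ z
      yxz≈z = begin
        y * (x * z)  ≈⟨ *-assoc y x z ⟨
        y * x * z    ≈⟨ *-congʳ (trans (*-comm y x) xy≈1) ⟩
        1# * z       ≈⟨ *-identityˡ z ⟩
        z            ∎

  module LowerTriangularInverse {m} {M N : Matrix m} (M-lower : LowerTriangular M)
                                (MN≈I : ∀ i j → (M ·ᴹ N) i j ≈ Idᴹ i j) where

    RowLower : Fin m → Set ℓ
    RowLower k = ∀ j → k Fin.< j → N k j ≈ 0#

    product-pivot : ∀ {k j} → (∀ {l} → l Fin.< k → RowLower l) → k Fin.≤ j →
                    (M ·ᴹ N) k j ≈ M k k * N k j
    product-pivot {k} {j} rows<k k≤j =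
      trans (reflexive (sumFin≡sum (λ l → M k l * N l j))) (sum-δ (λ l → M k l * N l j) k vanish)
      where
      vanish : ∀ l → l ≢ k → M k l * N l j ≈ 0#
      vanish l l≢k with Fin.<-cmp l k
      ... | tri< l<k _ _ = trans (*-congˡ (rows<k l<k j (ℕₚ.<-≤-trans l<k k≤j))) (zeroʳ _)
      ... | tri≈ _ l≡k _ = contradiction l≡k l≢k
      ... | tri> _ _ k<l = trans (*-congʳ (M-lower k l k<l)) (zeroˡ _)

    diagonal-pivot : ∀ {k} → (∀ {l} → l Fin.< k → RowLower l) → M k k * N k k ≈ 1#
    diagonal-pivot {k} rows<k =
      trans (sym (product-pivot rows<k Fin.≤-refl)) (trans (MN≈I k k) (Idᴹ-diag k))

    rowLower : ∀ k → (∀ {l} → l Fin.< k → RowLower l) → RowLower k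
    rowLower k rows<k j k<j = begin
      N k j                      ≈⟨ *-identityˡ (N k j) ⟨
      1# * N k j                 ≈⟨ *-congʳ (trans (sym (diagonal-pivot rows<k)) (*-comm _ _)) ⟩
      N k k * M k k * N k j      ≈⟨ *-assoc _ _ _ ⟩
      N k k * (M k k * N k j)    ≈⟨ *-congˡ (product-pivot rows<k (ℕₚ.<⇒≤ k<j)) ⟨
      N k k * (M ·ᴹ N) k j       ≈⟨ *-congˡ (trans (MN≈I k j) (Idᴹ-off (Fin.<⇒≢ k<j))) ⟩
      N k k * 0#                 ≈⟨ zeroʳ _ ⟩
      0#                         ∎

    lowerTriangular : LowerTriangular N
    lowerTriangular = WF.All.wfRec Fin.<-wellFounded ℓ RowLower rowLower

    diagonal : ∀ k → M k k * N k k ≈ 1#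
    diagonal k = diagonal-pivot (λ {l} _ → lowerTriangular l)

    module _ {K : Carrier → Set ℓ} (K-subfield : IsSubfield K) (0≉1 : ¬ 0# ≈ 1#)
             (M∈K : ∀ i j → K (M i j)) where
      open IsSubfield K-subfield
      open SubfieldProperties K-subfield

      RowInK : Fin m → Set ℓ
      RowInK i = ∀ j → K (N i j)

      -- Row i of M N = I reads M_ii N_ij + s = I_ij, where s ∈ K involves only rows above i.
      rowInK : ∀ i → (∀ {l} → l Fin.< i → RowInK l) → RowInK i
      rowInK i rows<i j with sum-pivot {P = K} has0 +-cl (λ l → M i l * N l j) i others∈K
        where
        others∈K : ∀ l → l ≢ i → K (M i l * N l j)
        others∈K l l≢i with Fin.<-cmp l i
        ... | tri< l<i _ _ = *-cl (M∈K i l) (rows<i l<i j)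
        ... | tri≈ _ l≡i _ = contradiction l≡i l≢i
        ... | tri> _ _ i<l = ≈0⇒∈K (trans (*-congʳ (M-lower i l i<l)) (zeroˡ _))
      ... | s , s∈K , sum≈ =
        *-cancelˡ-∈K (M∈K i i) Mii≉0 (resp pivot≈ (+-cl (Idᴹ∈K i j) (neg-cl s∈K)))
        where
        Mii≉0 : ¬ M i i ≈ 0#
        Mii≉0 Mii≈0 = 0≉1 (trans (sym (trans (*-congʳ Mii≈0) (zeroˡ _))) (diagonal i))
        row≈ : Idᴹ i j ≈ M i i * N i j + s
        row≈ = trans (sym (MN≈I i j)) (trans (reflexive (sumFin≡sum (λ l → M i l * N l j))) sum≈)
        pivot≈ : Idᴹ i j - s ≈ M i i * N i j
        pivot≈ = trans (+-congʳ row≈) (//-rightDividesʳ s (M i i * N i j))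

      inverse∈K : ∀ i j → K (N i j)
      inverse∈K = WF.All.wfRec Fin.<-wellFounded ℓ RowInK rowInK

  module _ {Gs : List Carrier} (G : IsAdditiveSubgroup Gs) {K : Carrier → Set ℓ}
           (G-space : IsVectorSpaceOver K Gs) {m : ℕ} where
    private module G = IsAdditiveSubgroup G

    ·ᵛ-∈𝒜 : ∀ {A : Matrix m} {v} → (∀ i j → K (A i j)) → v ∈𝒜 Gs → (A ·ᵛ v) ∈𝒜 Gs
    ·ᵛ-∈𝒜 {A} {v} A∈K v∈𝒜 i =
      ≡.subst (_∈G Gs) (≡.sym (sumFin≡sum (λ k → A i k * v k)))
        (sum-closed {P = _∈G Gs} G.has0 G.+-cl _ (λ k → G-space _ _ (A∈K i k) (v∈𝒜 k)))

    affine-∈𝒜 : ∀ {M : Matrix m} {b} → (∀ i j → K (M i j)) → b ∈𝒜 Gs →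
                ∀ P → P ∈𝒜 Gs → applyAffine M b P ∈𝒜 Gs
    affine-∈𝒜 M∈K b∈𝒜 P P∈𝒜 i = G.+-cl (·ᵛ-∈𝒜 M∈K P∈𝒜 i) (b∈𝒜 i)

    affine-surjective : ∀ {M N : Matrix m} {b} → (∀ i j → (M ·ᴹ N) i j ≈ Idᴹ i j) →
                        (∀ i j → K (N i j)) → b ∈𝒜 Gs →
                        ∀ Q → Q ∈𝒜 Gs → ∃ λ P → P ∈𝒜 Gs × (∀ i → applyAffine M b P i ≈ Q i)
    affine-surjective {M} {N} {b} MN≈I N∈K b∈𝒜 Q Q∈𝒜 =
      N ·ᵛ v , ·ᵛ-∈𝒜 N∈K (λ i → G.+-cl (Q∈𝒜 i) (G.neg-cl (b∈𝒜 i))) , hits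
      where
      v : Point m
      v i = Q i - b i
      hits : ∀ i → applyAffine M b (N ·ᵛ v) i ≈ Q i
      hits i = begin
        (M ·ᵛ N ·ᵛ v) i + b i       ≈⟨ +-congʳ (·ᵛ-assoc M N v i) ⟩
        ((M ·ᴹ N) ·ᵛ v) i + b i     ≈⟨ +-congʳ (·ᵛ-congˡ MN≈I v i) ⟩
        (Idᴹ ·ᵛ v) i + b i          ≈⟨ +-congʳ (Idᴹ-·ᵛ v i) ⟩
        Q i - b i + b i             ≈⟨ //-rightDividesˡ (b i) (Q i) ⟩
        Q i                         ∎

  module _ {m : ℕ} where

    infixl 7 _*ₜ_
    _*ₜ_ : Carrier × Monomial m → Carrier × Monomial m → Carrier × Monomial m
    t *ₜ s = proj₁ t * proj₁ s , zipWith ℕ._+_ (proj₂ t) (proj₂ s)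

    -- InSpan inspects every listed term, so terms with coefficient ≈ 0 must be deleted
    -- syntactically, not merely up to _≃ₚ_.
    data PrunesTo : Poly m → Poly m → Set (c ⊔ ℓ) where
      []   : PrunesTo [] []
      keep : ∀ {a a' e p q} → a ≈ a' → PrunesTo p q → PrunesTo ((a , e) ∷ p) ((a' , e) ∷ q)
      drop : ∀ {a e p q} → a ≈ 0# → PrunesTo p q → PrunesTo ((a , e) ∷ p) q

    prunesTo-refl : ∀ p → PrunesTo p p
    prunesTo-refl []            = []
    prunesTo-refl ((a , e) ∷ p) = keep refl (prunesTo-refl p)

    prunesTo-++ : ∀ {p q p' q'} → PrunesTo p q → PrunesTo p' q' → PrunesTo (p ++ p') (q ++ q')
    prunesTo-++ []            r' = r'
    prunesTo-++ (keep a≈a' r) r' = keep a≈a' (prunesTo-++ r r')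
    prunesTo-++ (drop a≈0 r)  r' = drop a≈0 (prunesTo-++ r r')

    prunesTo-dropAll : ∀ {z p q} → All (λ t → proj₁ t ≈ 0#) z → PrunesTo p q → PrunesTo (z ++ p) q
    prunesTo-dropAll []          r = r
    prunesTo-dropAll (t≈0 ∷ z≈0) r = drop t≈0 (prunesTo-dropAll z≈0 r)

    prunesTo-map-*ₜ : ∀ {a a' e q q'} → a ≈ a' → PrunesTo q q' →
                      PrunesTo (map ((a , e) *ₜ_) q) (map ((a' , e) *ₜ_) q')
    prunesTo-map-*ₜ a≈a' []            = []
    prunesTo-map-*ₜ a≈a' (keep x≈x' r) = keep (*-cong a≈a' x≈x') (prunesTo-map-*ₜ a≈a' r)
    prunesTo-map-*ₜ a≈a' (drop x≈0 r)  = drop (trans (*-congˡ x≈0) (zeroʳ _)) (prunesTo-map-*ₜ a≈a' r)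

    prunesTo-*ₚ : ∀ {p p' q q'} → PrunesTo p p' → PrunesTo q q' → PrunesTo (p *ₚ q) (p' *ₚ q')
    prunesTo-*ₚ []                   r' = []
    prunesTo-*ₚ (keep a≈a' r)        r' = prunesTo-++ (prunesTo-map-*ₜ a≈a' r') (prunesTo-*ₚ r r')
    prunesTo-*ₚ {q = q} (drop a≈0 r) r' =
      prunesTo-dropAll (map⁺ (All.universal zero-term q)) (prunesTo-*ₚ r r')
      where
      zero-term : ∀ s → _ * proj₁ s ≈ 0#
      zero-term s = trans (*-congʳ a≈0) (zeroˡ (proj₁ s))

    prunesTo-^ₚ : ∀ {p q} → PrunesTo p q → ∀ n → PrunesTo (p ^ₚ n) (q ^ₚ n)
    prunesTo-^ₚ r zero    = prunesTo-refl oneₚ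
    prunesTo-^ₚ r (suc n) = prunesTo-*ₚ r (prunesTo-^ₚ r n)

    prunesTo-sumFinₚ : ∀ {n} {f g : Fin n → Poly m} → (∀ i → PrunesTo (f i) (g i)) →
                       PrunesTo (sumFinₚ f) (sumFinₚ g)
    prunesTo-sumFinₚ {zero}  r = []
    prunesTo-sumFinₚ {suc n} r = prunesTo-++ (r Fin.zero) (prunesTo-sumFinₚ (r ∘ Fin.suc))

    prunesTo-prodFinₚ : ∀ {n} {f g : Fin n → Poly m} → (∀ i → PrunesTo (f i) (g i)) →
                        PrunesTo (prodFinₚ f) (prodFinₚ g)
    prunesTo-prodFinₚ {zero}  r = prunesTo-refl oneₚ
    prunesTo-prodFinₚ {suc n} r = prunesTo-*ₚ (r Fin.zero) (prunesTo-prodFinₚ (r ∘ Fin.suc))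

    prunesTo⇒≃ₚ : ∀ {p q} → PrunesTo p q → p ≃ₚ q
    prunesTo⇒≃ₚ [] d = refl
    prunesTo⇒≃ₚ (keep {e = e} a≈a' r) d with ≡-dec ℕ._≟_ e d
    ... | yes _ = +-cong a≈a' (prunesTo⇒≃ₚ r d)
    ... | no  _ = prunesTo⇒≃ₚ r d
    prunesTo⇒≃ₚ (drop {e = e} a≈0 r) d with ≡-dec ℕ._≟_ e d
    ... | yes _ = trans (+-cong a≈0 (prunesTo⇒≃ₚ r d)) (+-identityˡ _)
    ... | no  _ = prunesTo⇒≃ₚ r d

    coeff-+ₚ : ∀ (p q : Poly m) d → coeff (p +ₚ q) d ≈ coeff p d + coeff q d
    coeff-+ₚ []            q d = sym (+-identityˡ _)
    coeff-+ₚ ((a , e) ∷ p) q d with ≡-dec ℕ._≟_ e d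
    ... | yes _ = trans (+-congˡ (coeff-+ₚ p q d)) (sym (+-assoc _ _ _))
    ... | no  _ = coeff-+ₚ p q d

    coeff--ₚ : ∀ (p : Poly m) d → coeff (-ₚ p) d ≈ - coeff p d
    coeff--ₚ []            d = sym ε⁻¹≈ε
    coeff--ₚ ((a , e) ∷ p) d with ≡-dec ℕ._≟_ e d
    ... | yes _ = trans (+-congˡ (coeff--ₚ p d)) (⁻¹-∙-comm a (coeff p d))
    ... | no  _ = coeff--ₚ p d

    sumFinₚ-[] : ∀ n → sumFinₚ {m} {n} (λ _ → []) ≡ []
    sumFinₚ-[] zero    = ≡.refl
    sumFinₚ-[] (suc n) = sumFinₚ-[] n

    ≃ₚ⇒ReductionInSpan : ∀ {Gs} {L : Monomial m → Set} {g h} → InSpan L h → g ≃ₚ h →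
                         ReductionInSpan Gs L g
    ≃ₚ⇒ReductionInSpan {Gs} {g = g} {h} h∈L g≃h = h , h∈L , (λ _ → []) , λ d → begin
      coeff (g +ₚ (-ₚ h)) d                          ≈⟨ coeff-+ₚ g (-ₚ h) d ⟩
      coeff g d + coeff (-ₚ h) d                     ≈⟨ +-cong (g≃h d) (coeff--ₚ h d) ⟩
      coeff h d - coeff h d                          ≈⟨ -‿inverseʳ _ ⟩
      0#                                             ≡⟨ ≡.cong (λ p → coeff p d) (sumFinₚ-[] m) ⟨
      coeff (sumFinₚ (λ j → [] *ₚ idealGen Gs j)) d  ∎

  module Dominance {m : ℕ} (L : Monomial m → Set) (L-closed : DivisibilityClosed L) where

    Exponent : Set
    Exponent = Fin m → ℕ

    infixl 6 _⊕_
    _⊕_ : Exponent → Exponent → Exponent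
    (d ⊕ d') j = d j ℕ.+ d' j

    InL : Exponent → Set
    InL d = L (tabulate d)

    InL-mono : ∀ {d d'} → (∀ j → d j ≤ d' j) → InL d' → InL d
    InL-mono {d} {d'} d≤d' d'∈L = L-closed _ _ d'∈L λ j →
      ≡.subst₂ _≤_ (≡.sym (lookup∘tabulate d j)) (≡.sym (lookup∘tabulate d' j)) (d≤d' j)

    InL-cong : ∀ {d d'} → (∀ j → d j ≡ d' j) → InL d' → InL d
    InL-cong d≡d' = InL-mono (ℕₚ.≤-reflexive ∘ d≡d')

    infix 4 _≼_
    _≼_ : Exponent → Exponent → Set
    a ≼ a' = ∀ d → InL (d ⊕ a') → InL (d ⊕ a)

    ≼-refl : ∀ {a} → a ≼ a
    ≼-refl d d⊕a∈L = d⊕a∈L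

    ≼-trans : ∀ {a a' a''} → a ≼ a' → a' ≼ a'' → a ≼ a''
    ≼-trans a≼a' a'≼a'' d = a≼a' d ∘ a'≼a'' d

    ≤⇒≼ : ∀ {a a'} → (∀ j → a j ≤ a' j) → a ≼ a'
    ≤⇒≼ a≤a' d = InL-mono (λ j → ℕₚ.+-monoʳ-≤ (d j) (a≤a' j))

    ⊕-mono-≼ : ∀ {a a' b b'} → a ≼ a' → b ≼ b' → a ⊕ b ≼ a' ⊕ b'
    ⊕-mono-≼ {a} {a'} {b} {b'} a≼a' b≼b' d =
      InL-cong (λ j → ≡.sym (ℕₚ.+-assoc (d j) (a j) (b j))) ∘ b≼b' (d ⊕ a) ∘
      InL-cong (λ j → swap (d j) (a j) (b' j)) ∘ a≼a' (d ⊕ b') ∘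
      InL-cong (λ j → ≡.trans (swap (d j) (b' j) (a' j)) (ℕₚ.+-assoc (d j) (a' j) (b' j)))
      where
      swap : ∀ x y z → x ℕ.+ y ℕ.+ z ≡ x ℕ.+ z ℕ.+ y
      swap x y z = ≡.trans (ℕₚ.+-assoc x y z)
                           (≡.trans (≡.cong (x ℕ.+_) (ℕₚ.+-comm y z)) (≡.sym (ℕₚ.+-assoc x z y)))

    exponent : Carrier × Monomial m → Exponent
    exponent t = lookup (proj₂ t)

    DominatedBy : Poly m → Exponent → Set c
    DominatedBy p a = All (λ t → exponent t ≼ a) p

    dominated-≼ : ∀ {p a a'} → DominatedBy p a → a ≼ a' → DominatedBy p a'
    dominated-≼ p≼a a≼a' = All.map (λ t≼a → ≼-trans t≼a a≼a') p≼a

    dominated-sumFinₚ : ∀ {n a} {f : Fin n → Poly m} → (∀ i → DominatedBy (f i) a) →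
                        DominatedBy (sumFinₚ f) a
    dominated-sumFinₚ {zero}  f≼a = []
    dominated-sumFinₚ {suc n} f≼a = ++⁺ (f≼a Fin.zero) (dominated-sumFinₚ (f≼a ∘ Fin.suc))

    dominated-constₚ : ∀ x a → DominatedBy (constₚ x) a
    dominated-constₚ x a = ≤⇒≼ (λ j → ℕₚ.≤-trans (ℕₚ.≤-reflexive (lookup-replicate j 0)) ℕ.z≤n) ∷ []

    dominated-*ₚ : ∀ {p q a b} → DominatedBy p a → DominatedBy q b → DominatedBy (p *ₚ q) (a ⊕ b)
    dominated-*ₚ p≼a q≼b =
      concat⁺ (map⁺ (All.map (λ {t} t≼a → map⁺ (All.map (λ {s} → product {t} {s} t≼a) q≼b)) p≼a))
      where
      product : ∀ {t s a b} → exponent t ≼ a → exponent s ≼ b → exponent (t *ₜ s) ≼ a ⊕ b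
      product {t} {s} t≼a s≼b =
        ≼-trans (≤⇒≼ (λ j → ℕₚ.≤-reflexive (lookup-zipWith ℕ._+_ j (proj₂ t) (proj₂ s))))
                (⊕-mono-≼ t≼a s≼b)

    dominated-^ₚ : ∀ {p a} → DominatedBy p a → ∀ n → DominatedBy (p ^ₚ n) (λ j → n ℕ.* a j)
    dominated-^ₚ p≼a zero    = dominated-constₚ 1# _
    dominated-^ₚ p≼a (suc n) = dominated-*ₚ p≼a (dominated-^ₚ p≼a n)

    module ℕΣ = SumProperties ℕₚ.+-0-commutativeMonoid

    dominated-prodFinₚ : ∀ {n} {f : Fin n → Poly m} {a : Fin n → Exponent} →
                         (∀ i → DominatedBy (f i) (a i)) →
                         DominatedBy (prodFinₚ f) (λ j → ℕΣ.sum (λ i → a i j))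
    dominated-prodFinₚ {zero}  f≼a = dominated-constₚ 1# _
    dominated-prodFinₚ {suc n} f≼a = dominated-*ₚ (f≼a Fin.zero) (dominated-prodFinₚ (f≼a ∘ Fin.suc))

    dominated⇒InSpan : ∀ {p a} → DominatedBy p a → InL a → InSpan L p
    dominated⇒InSpan p≼a a∈L =
      All.map (λ {t} t≼a → ≡.subst L (tabulate∘lookup (proj₂ t)) (t≼a (λ _ → 0) a∈L)) p≼a

  module BorelSubstitution {m : ℕ} {L : Monomial m → Set} (L-closed : DivisibilityClosed L)
                           (L-borel : Borel L) (M : Matrix m) (b : Point m) where
    open Dominance L L-closed

    δ : Fin m → Exponent
    δ k j with k Fin.≟ j
    ... | yes _ = 1
    ... | no  _ = 0

    δ-diag : ∀ k → δ k k ≡ 1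
    δ-diag k with k Fin.≟ k
    ... | yes _   = ≡.refl
    ... | no k≢k = contradiction ≡.refl k≢k

    δ-off : ∀ {k j} → k ≢ j → δ k j ≡ 0
    δ-off {k} {j} k≢j with k Fin.≟ j
    ... | yes k≡j = contradiction k≡j k≢j
    ... | no  _   = ≡.refl

    δ-≼ : ∀ {k i} → k Fin.< i → δ k ≼ δ i
    δ-≼ {k} {i} k<i d d⊕δi∈L = L-closed _ _ (L-borel _ i k d⊕δi∈L one≤ k<i) λ j →
      ℕₚ.≤-reflexive (≡.trans (lookup∘tabulate (d ⊕ δ k) j) (moved j))
      where
      one≤ : 1 ≤ lookup (tabulate (d ⊕ δ i)) i
      one≤ rewrite lookup∘tabulate (d ⊕ δ i) i | δ-diag i = ℕₚ.m≤n+m 1 (d i)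
      moved : ∀ j → d j ℕ.+ δ k j ≡ lookup (updateAt (updateAt (tabulate (d ⊕ δ i)) i ℕ.pred) k suc) j
      moved j with j Fin.≟ k | j Fin.≟ i
      ... | yes ≡.refl | _
        rewrite lookup∘updateAt j {suc} (updateAt (tabulate (d ⊕ δ i)) i ℕ.pred)
              | lookup∘updateAt′ j i {ℕ.pred} (Fin.<⇒≢ k<i) (tabulate (d ⊕ δ i))
              | lookup∘tabulate (d ⊕ δ i) j | δ-diag j | δ-off (Fin.<⇒≢ k<i ∘ ≡.sym)
              = ℕₚ.+-suc (d j) 0
      ... | no j≢k | yes ≡.refl
        rewrite lookup∘updateAt′ j k {suc} j≢k (updateAt (tabulate (d ⊕ δ j)) j ℕ.pred)
              | lookup∘updateAt j {ℕ.pred} (tabulate (d ⊕ δ j))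
              | lookup∘tabulate (d ⊕ δ j) j | δ-diag j | δ-off (Fin.<⇒≢ k<i) | ℕₚ.+-suc (d j) 0
              = ≡.refl
      ... | no j≢k | no j≢i
        rewrite lookup∘updateAt′ j k {suc} j≢k (updateAt (tabulate (d ⊕ δ i)) i ℕ.pred)
              | lookup∘updateAt′ j i {ℕ.pred} j≢i (tabulate (d ⊕ δ i))
              | lookup∘tabulate (d ⊕ δ i) j | δ-off (j≢k ∘ ≡.sym) | δ-off (j≢i ∘ ≡.sym)
              = ≡.refl

    -- The exponent vector of varₚ k is tabulated by a function local to Defs, which cannot be
    -- named; the first `with` captures it in the type of eq, where the second can then evaluate it.
    varₚ-exponent : ∀ k j → All (λ t → exponent t j ≡ δ k j) (varₚ k)
    varₚ-exponent k j with (map (λ t → exponent t j) (varₚ k) ≡ _) ∋ ≡.cong (_∷ []) (lookup∘tabulate _ j)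
    ... | eq with k Fin.≟ j
    ...   | yes _ = List.∷-injectiveˡ eq ∷ []
    ...   | no  _ = List.∷-injectiveˡ eq ∷ []

    dominated-varₚ : ∀ k → DominatedBy (varₚ k) (δ k)
    dominated-varₚ k = ≤⇒≼ (λ j → ℕₚ.≤-reflexive (All.head (varₚ-exponent k j))) ∷ []

    lowerTerm : Fin m → Fin m → Poly m
    lowerTerm i k with k Fin.≤? i
    ... | yes _ = constₚ (M i k) *ₚ varₚ k
    ... | no  _ = []

    lowerRowₚ : Fin m → Poly m
    lowerRowₚ i = sumFinₚ (lowerTerm i) +ₚ constₚ (b i)

    triangularImage : Monomial m → Poly m
    triangularImage e = prodFinₚ (λ i → lowerRowₚ i ^ₚ lookup e i)

    affineImage-prunesTo : LowerTriangular M → ∀ e → PrunesTo (affineImage M b e) (triangularImage e)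
    affineImage-prunesTo M-lower e = prunesTo-prodFinₚ λ i →
      prunesTo-^ₚ (prunesTo-++ (prunesTo-sumFinₚ (lowerTerm-pruned i)) (prunesTo-refl _)) (lookup e i)
      where
      lowerTerm-pruned : ∀ i k → PrunesTo (constₚ (M i k) *ₚ varₚ k) (lowerTerm i k)
      lowerTerm-pruned i k with k Fin.≤? i
      ... | yes _   = prunesTo-refl _
      ... | no  k≰i = drop (trans (*-identityʳ _) (M-lower i k (ℕₚ.≰⇒> k≰i))) []

    lowerRowₚ-dominated : ∀ i → DominatedBy (lowerRowₚ i) (δ i)
    lowerRowₚ-dominated i = ++⁺ (dominated-sumFinₚ lowerTerm-dominated) (dominated-constₚ (b i) (δ i))
      where
      lowerTerm-dominated : ∀ k → DominatedBy (lowerTerm i k) (δ i)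
      lowerTerm-dominated k with k Fin.≤? i
      ... | no  _   = []
      ... | yes k≤i =
        dominated-≼ (dominated-*ₚ (dominated-constₚ (M i k) (λ _ → 0)) (dominated-varₚ k)) δk≼δi
        where
        δk≼δi : δ k ≼ δ i
        δk≼δi with k Fin.≟ i
        ... | yes ≡.refl = ≼-refl
        ... | no  k≢i    = δ-≼ (Fin.≤∧≢⇒< k≤i k≢i)

    triangularImage-InSpan : ∀ e → L e → InSpan L (triangularImage e)
    triangularImage-InSpan e e∈L =
      dominated⇒InSpan (dominated-≼ product≼ (≤⇒≼ (ℕₚ.≤-reflexive ∘ exponent-sum)))
                       (≡.subst L (≡.sym (tabulate∘lookup e)) e∈L)
      where
      product≼ : DominatedBy (triangularImage e) (λ j → ℕΣ.sum (λ i → lookup e i ℕ.* δ i j))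
      product≼ = dominated-prodFinₚ (λ i → dominated-^ₚ (lowerRowₚ-dominated i) (lookup e i))
      exponent-sum : ∀ j → ℕΣ.sum (λ i → lookup e i ℕ.* δ i j) ≡ lookup e j
      exponent-sum j =
        ≡.trans (ℕΣ.sum-δ _ j off-diagonal)
                (≡.trans (≡.cong (lookup e j ℕ.*_) (δ-diag j)) (ℕₚ.*-identityʳ (lookup e j)))
        where
        off-diagonal : ∀ i → i ≢ j → lookup e i ℕ.* δ i j ≡ 0
        off-diagonal i i≢j = ≡.trans (≡.cong (lookup e i ℕ.*_) (δ-off i≢j)) (ℕₚ.*-zeroʳ (lookup e i))

theorem4 : ∀ {c ℓ} (R : CommutativeRing c ℓ) → IsFiniteField R →
    let open CommutativeRing R in
    let open Cartesian R in
    ∀ (m : ℕ) (Gs : List Carrier) → IsAdditiveSubgroup Gs → 2 ≤ length Gs →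
    ∀ (K : Carrier → Set ℓ) → IsLargestSubfieldFor K Gs →
    ∀ (L : Monomial m → Set) → InΔ Gs L → DivisibilityClosed L → Borel L →
    ∀ (M : Matrix m) (b : Point m) →
    (∀ i → b i ∈G Gs) → Nonsingular M → LowerTriangular M → (∀ i j → K (M i j)) →
    InPermA Gs L M b
theorem4 R R-field m Gs G _ K (K-subfield , G-space , _) L _ L-closed L-borel
         M b b∈𝒜 (N , MN≈I , _) M-lower M∈K =
    affine-∈𝒜 G G-space M∈K b∈𝒜
  , affine-surjective G G-space MN≈I N∈K b∈𝒜
  , λ e e∈L → ≃ₚ⇒ReductionInSpan {Gs = Gs} {g = affineImage M b e}
                (triangularImage-InSpan e e∈L) (prunesTo⇒≃ₚ (affineImage-prunesTo M-lower e))
  where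
  open Cartesian R
  open CartesianProperties R
  open LowerTriangularInverse M-lower MN≈I
  open BorelSubstitution L-closed L-borel M b

  N∈K : ∀ i j → K (N i j)
  N∈K = inverse∈K K-subfield (IsFiniteField.0≉1 R-field) M∈K
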